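{- Let $G$ be a graph with $G = A \cup B$, where $A$ and $B$ are connected subgraphs of $G$, each with at least two vertices, and $V(A)\cap V(B)=\{x\}$. Then: (a0) if $v(A)\equiv 0 \pmod 3$, then $\lambda(G)\le v(A)/3+\lambda(B-x)$; (a1) if $v(A)\equiv 1 \pmod 3$, then $\lambda(G)\le (v(A)-1)/3+\lambda(B)$; (a2) if $v(A)\equiv 2 \pmod 3$, then $\lambda(G)\le (v(A)-2)/3+\lambda(B\cup xy)$ for every edge $xy\in E(A)$, where $B\cup xy$ denotes the graph obtained from $B$ by adding the vertex $y$ and the edge $xy$.
   Context: All graphs are finite, simple and undirected. $v(H)$ is the number of vertices of $H$. For a graph $H$, $\lambda(H)$ denotes the maximum number of pairwise vertex-disjoint 3-vertex paths (subgraphs isomorphic to $P_3$, not necessarily induced) in $H$. For a vertex $x$, $H-x$ is the graph obtained by deleting $x$. -}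

module Defs where

open import Data.Nat using (ℕ; zero; suc; _+_)
open import Data.Bool using (Bool; true; false; _∧_; _∨_; not; if_then_else_)
open import Data.Fin using (Fin; zero; suc; _≟_)
open import Data.Product using (Σ; _×_; _,_)
open import Data.List using (List; length; concatMap; _∷_; [])
open import Data.List.Relation.Unary.All using (All)
open import Data.List.Relation.Unary.Unique.Propositional using (Unique)
open import Relation.Binary.PropositionalEquality using (_≡_)
open import Relation.Nullary.Decidable using (⌊_⌋)

-- A (raw) graph whose vertex set is a subset of the finite universe Fin n:
-- V u = true  iff u is a vertex;  E u v = true iff uv is an edge.
record Graph (n : ℕ) : Set where
  constructor graph
  field
    V : Fin n → Bool
    E : Fin n → Fin n → Bool
open Graph public

record IsGraph {n : ℕ} (H : Graph n) : Set where
  field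
    E-sym : ∀ u v → E H u v ≡ E H v u
    E-irr : ∀ u → E H u u ≡ false
    E-V   : ∀ u v → E H u v ≡ true → V H u ≡ true

_==_ : ∀ {n} → Fin n → Fin n → Bool
u == v = ⌊ u ≟ v ⌋

count : ∀ {n} → (Fin n → Bool) → ℕ
count {zero}  f = 0
count {suc n} f = (if f zero then 1 else 0) + count (λ i → f (suc i))

v : ∀ {n} → Graph n → ℕ
v H = count (V H)

IsUnion : ∀ {n} → Graph n → Graph n → Graph n → Set
IsUnion G A B = (∀ u → V G u ≡ (V A u ∨ V B u))
              × (∀ u w → E G u w ≡ (E A u w ∨ E B u w))

MeetExactlyAt : ∀ {n} → Graph n → Graph n → Fin n → Set
MeetExactlyAt A B x = (V A x ≡ true) × (V B x ≡ true)
                    × (∀ u → V A u ≡ true → V B u ≡ true → u ≡ x)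

data Reach {n : ℕ} (H : Graph n) : Fin n → Fin n → Set where
  here : ∀ {u} → V H u ≡ true → Reach H u u
  step : ∀ {u w t} → E H u w ≡ true → Reach H w t → Reach H u t

Connected : ∀ {n} → Graph n → Set
Connected H = ∀ u w → V H u ≡ true → V H w ≡ true → Reach H u w

_─_ : ∀ {n} → Graph n → Fin n → Graph n
H ─ x = graph (λ u → V H u ∧ not (u == x))
              (λ u w → E H u w ∧ (not (u == x) ∧ not (w == x)))

addEdge : ∀ {n} → Graph n → Fin n → Fin n → Graph n
addEdge H x y = graph (λ u → V H u ∨ (u == y))
                      (λ u w → E H u w ∨ (((u == x) ∧ (w == y)) ∨ ((u == y) ∧ (w == x))))

-- a 3-vertex path a - b - c (b the middle vertex), not necessarily induced
record Triple (n : ℕ) : Set where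
  constructor tri
  field
    t₁ t₂ t₃ : Fin n

IsP3 : ∀ {n} → Graph n → Triple n → Set
IsP3 H (tri a b c) = (V H a ≡ true) × (V H b ≡ true) × (V H c ≡ true)
                   × (E H a b ≡ true) × (E H b c ≡ true)

verts : ∀ {n} → Triple n → List (Fin n)
verts (tri a b c) = a ∷ b ∷ c ∷ []

-- H contains m pairwise vertex-disjoint P3's
-- (all 3m listed vertices are pairwise distinct; in particular each triple is a genuine path)
HasPacking : ∀ {n} → Graph n → ℕ → Set
HasPacking H m = Σ (List (Triple _)) λ ps →
  (length ps ≡ m) × All (IsP3 H) ps × Unique (concatMap verts ps)

IsLambda : ∀ {n} → Graph n → ℕ → Set
IsLambda H k = HasPacking H k × (∀ m → HasPacking H m → m Data.Nat.≤ k)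

module Submission where

-- Let ps be a maximum P3-packing of G = A ∪ B, where A and B
-- meet only in the cut vertex x.  Since no edge joins A − x to B − x, every
-- path of ps avoiding x lies entirely inside A − x or entirely outside it;
-- by disjointness at most one path of ps passes through x.  Write w(t) and
-- c(t) for the numbers of vertices of a path t in A − x and equal to x.
--
-- For each residue r = v(A) mod 3 we choose a set of "light" paths of ps and
-- turn it into a packing of the graph B' of the statement (B − x, B, or
-- B ∪ xy, where the light paths are pushed into B ∪ xy by collapsing A − x
-- onto y).  A heavy path always has 3 ≤ w(t) + s·c(t), with s = 3 − r, so
--     3·|ps| ≤ Σ w + s·Σ c + 3·#light ≤ (v(A) − 1) + s + 3·λ(B'),
-- using that the used vertices of A − x together with x are distinct vertices
-- of A and that x occurs at most once.  Dividing by 3 gives the theorem.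

open import Defs
open import Data.Nat using (ℕ; zero; suc; _+_; _*_; _∸_; _≤_; z≤n; s≤s; _≤?_)
open import Data.Nat.Properties hiding (_≟_)
import Data.Nat as Nat
open import Data.Nat.DivMod using (_/_; _%_; m≡m%n+[m/n]*n; m*n/n≡m)
open import Data.Nat.Tactic.RingSolver using (solve-∀)
open import Data.Bool using (Bool; true; false; _∧_; _∨_; not)
import Data.Bool.Properties as Bool
open import Data.Fin using (Fin; zero; suc; _≟_)
open import Data.Product using (_×_; _,_; proj₁; proj₂)
open import Data.Sum using (_⊎_; inj₁; inj₂)
open import Data.Empty using (⊥; ⊥-elim)
open import Data.List using (List; []; _∷_; length; map; filter; concatMap)
open import Data.List.Properties using (length-++; filter-++; filter-all; filter-none; filter-accept; length-map)
open import Data.List.Relation.Unary.All as All using (All; []; _∷_)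
import Data.List.Relation.Unary.All.Properties as All
open import Data.List.Relation.Unary.Unique.Propositional using (Unique; []; _∷_)
import Data.List.Relation.Unary.Unique.Propositional.Properties as Unique
open import Data.List.Relation.Binary.Sublist.Propositional using (_⊆_; []; _∷_; _∷ʳ_; ⊆-refl)
import Data.List.Relation.Binary.Sublist.Propositional.Properties as Sublist
open import Function using (_∘_)
open import Relation.Binary.PropositionalEquality
open import Relation.Nullary using (¬_; yes; no; does; ¬?)
open import Relation.Nullary.Decidable using (_×-dec_)
open import Relation.Unary using (Pred; Decidable; ∁)

private variable
  n : ℕ

predecessors : List (Fin (suc n)) → List (Fin n)
predecessors []           = []
predecessors (zero  ∷ us) = predecessors us
predecessors (suc u ∷ us) = u ∷ predecessors us

All-predecessors : ∀ {ℓ} {P : Pred (Fin (suc n)) ℓ} {us} → All P us → All (P ∘ suc) (predecessors us)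
All-predecessors {us = []}        []       = []
All-predecessors {us = zero  ∷ _} (_ ∷ ps) = All-predecessors ps
All-predecessors {us = suc _ ∷ _} (p ∷ ps) = p ∷ All-predecessors ps

unique-predecessors : ∀ {us : List (Fin (suc n))} → Unique us → Unique (predecessors us)
unique-predecessors {us = []}        []       = []
unique-predecessors {us = zero  ∷ _} (_ ∷ uq) = unique-predecessors uq
unique-predecessors {us = suc _ ∷ _} (u∉ ∷ uq) =
  All.map (λ u≢v u≡v → u≢v (cong suc u≡v)) (All-predecessors u∉) ∷ unique-predecessors uq

length-predecessors-nonzero : ∀ {us : List (Fin (suc n))} → All (zero ≢_) us
  → length us ≡ length (predecessors us)
length-predecessors-nonzero {us = []}        []       = refl
length-predecessors-nonzero {us = zero  ∷ _} (z≢z ∷ _) = ⊥-elim (z≢z refl)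
length-predecessors-nonzero {us = suc _ ∷ _} (_ ∷ zs)  = cong suc (length-predecessors-nonzero zs)

length-predecessors : ∀ {us : List (Fin (suc n))} → Unique us
  → length us ≤ suc (length (predecessors us))
length-predecessors {us = []}        []        = z≤n
length-predecessors {us = zero  ∷ _} (z∉ ∷ _)  = s≤s (≤-reflexive (length-predecessors-nonzero z∉))
length-predecessors {us = suc _ ∷ _} (_ ∷ uq)  = s≤s (length-predecessors uq)

count-bound : (f : Fin n → Bool) (us : List (Fin n)) → Unique us
  → All (λ u → f u ≡ true) us → length us ≤ count f
count-bound {zero}  f []       _  _ = z≤n
count-bound {zero}  f (() ∷ _) _  _
count-bound {suc n} f us       uq fs with f zero in f0
... | true  = ≤-trans (length-predecessors uq)
                      (s≤s (count-bound (f ∘ suc) _ (unique-predecessors uq) (All-predecessors fs)))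
... | false = ≤-trans (≤-reflexive (length-predecessors-nonzero (All.map zero-absent fs)))
                      (count-bound (f ∘ suc) _ (unique-predecessors uq) (All-predecessors fs))
  where
  zero-absent : ∀ {u} → f u ≡ true → zero ≢ u
  zero-absent fu refl with trans (sym fu) f0
  ... | ()

unique-constant : ∀ {A : Set} {a : A} {us} → Unique us → All (_≡ a) us → length us ≤ 1
unique-constant []                        _                   = z≤n
unique-constant (_ ∷ [])                  _                   = s≤s z≤n
unique-constant ((u≢v ∷ _) ∷ _) (refl ∷ refl ∷ _) = ⊥-elim (u≢v refl)

unique-⊆ : ∀ {A : Set} {xs ys : List A} → xs ⊆ ys → Unique ys → Unique xs
unique-⊆ []         []         = []
unique-⊆ (_ ∷ʳ τ)   (_ ∷ uq)   = unique-⊆ τ uq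
unique-⊆ (refl ∷ τ) (y∉ ∷ uq)  = Sublist.All-resp-⊆ τ y∉ ∷ unique-⊆ τ uq

All-filter : ∀ {A : Set} {q r} {Q : Pred A q} {R : Pred A r} (Q? : Decidable Q) {xs}
  → All (λ a → Q a → R a) xs → All R (filter Q? xs)
All-filter Q? {xs} h = All.zipWith (λ (f , q) → f q) (All.filter⁺ Q? h , All.all-filter Q? xs)

-- Weighted counting over families of paths

vertices : List (Triple n) → List (Fin n)
vertices = concatMap verts

vertices-filter-⊆ : ∀ {q} {Q : Pred (Triple n) q} (Q? : Decidable Q) ps
  → vertices (filter Q? ps) ⊆ vertices ps
vertices-filter-⊆ Q? []       = []
vertices-filter-⊆ Q? (t ∷ ps) with does (Q? t)
... | true  = Sublist.++⁺ ⊆-refl (vertices-filter-⊆ Q? ps)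
... | false = Sublist.++⁺ˡ (verts t) (vertices-filter-⊆ Q? ps)

occ₃ : ∀ {ℓ} {P : Pred (Fin n) ℓ} → Decidable P → Triple n → ℕ
occ₃ P? t = length (filter P? (verts t))

occ : ∀ {ℓ} {P : Pred (Fin n) ℓ} → Decidable P → List (Triple n) → ℕ
occ P? ps = length (filter P? (vertices ps))

module _ {n ℓ} {P : Pred (Fin n) ℓ} (P? : Decidable P) where

  occ-∷ : ∀ t ps → occ P? (t ∷ ps) ≡ occ₃ P? t + occ P? ps
  occ-∷ t ps = trans (cong length (filter-++ P? (verts t) (vertices ps)))
                     (length-++ (filter P? (verts t)))

  occ-filter : ∀ {q} {Q : Pred (Triple n) q} (Q? : Decidable Q) ps → occ P? (filter Q? ps) ≤ occ P? ps
  occ-filter Q? ps =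
    Sublist.length-mono-≤ (Sublist.filter⁺ P? P? (λ { refl p → p }) (vertices-filter-⊆ Q? ps))

occ-mono : ∀ {n ℓ r} {P : Pred (Fin n) ℓ} {R : Pred (Fin n) r} (P? : Decidable P) (R? : Decidable R) ps
  → All (λ t → occ₃ P? t ≤ occ₃ R? t) ps → occ P? ps ≤ occ R? ps
occ-mono P? R? []       []       = z≤n
occ-mono P? R? (t ∷ ps) (h ∷ hs) = begin
  occ P? (t ∷ ps)           ≡⟨ occ-∷ P? t ps ⟩
  occ₃ P? t + occ P? ps     ≤⟨ +-mono-≤ h (occ-mono P? R? ps hs) ⟩
  occ₃ R? t + occ R? ps     ≡⟨ occ-∷ R? t ps ⟨
  occ R? (t ∷ ps)           ∎
  where open ≤-Reasoning

weighted-count : ∀ {n ℓ r q} {P : Pred (Fin n) ℓ} {R : Pred (Fin n) r} {Q : Pred (Triple n) q}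
  (P? : Decidable P) (R? : Decidable R) (Q? : Decidable Q) (s : ℕ) ps
  → All (λ t → ¬ Q t → 3 ≤ occ₃ P? t + s * occ₃ R? t) ps
  → 3 * length ps ≤ occ P? ps + s * occ R? ps + 3 * length (filter Q? ps)
weighted-count P? R? Q? s []       []           = z≤n
weighted-count P? R? Q? s (t ∷ ps) (heavy ∷ hs)
  rewrite occ-∷ P? t ps | occ-∷ R? t ps
  with ih ← weighted-count P? R? Q? s ps hs | Q? t
... | yes _  = begin
  3 * suc (length ps)                                   ≡⟨ *-suc 3 (length ps) ⟩
  3 + 3 * length ps                                     ≤⟨ +-monoʳ-≤ 3 ih ⟩
  3 + (occ P? ps + s * occ R? ps + 3 * F)               ≤⟨ m≤m+n _ _ ⟩
  3 + (occ P? ps + s * occ R? ps + 3 * F) + (occ₃ P? t + s * occ₃ R? t)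
    ≡⟨ regroup-accepted (occ₃ P? t) (occ₃ R? t) (occ P? ps) (occ R? ps) F s ⟨
  occ₃ P? t + occ P? ps + s * (occ₃ R? t + occ R? ps) + 3 * suc F  ∎
  where
  open ≤-Reasoning
  F = length (filter Q? ps)
  regroup-accepted : ∀ p r P R F s
    → p + P + s * (r + R) + 3 * suc F ≡ 3 + (P + s * R + 3 * F) + (p + s * r)
  regroup-accepted = solve-∀
... | no rejected = begin
  3 * suc (length ps)                                   ≡⟨ *-suc 3 (length ps) ⟩
  3 + 3 * length ps                                     ≤⟨ +-mono-≤ (heavy rejected) ih ⟩
  (occ₃ P? t + s * occ₃ R? t) + (occ P? ps + s * occ R? ps + 3 * F)
    ≡⟨ regroup-rejected (occ₃ P? t) (occ₃ R? t) (occ P? ps) (occ R? ps) F s ⟨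
  occ₃ P? t + occ P? ps + s * (occ₃ R? t + occ R? ps) + 3 * F  ∎
  where
  open ≤-Reasoning
  F = length (filter Q? ps)
  regroup-rejected : ∀ p r P R F s
    → p + P + s * (r + R) + 3 * F ≡ (p + s * r) + (P + s * R + 3 * F)
  regroup-rejected = solve-∀

module _ {A : Set} {ℓ} {P : Pred A ℓ} (P? : Decidable P) where

  filter-empty : ∀ xs → length (filter P? xs) ≡ 0 → All (∁ P) xs
  filter-empty []       _ = []
  filter-empty (x ∷ xs) h with P? x
  ... | no ¬px = ¬px ∷ filter-empty xs h

  filter-∷-≤ : ∀ u us → length (filter P? us) ≤ length (filter P? (u ∷ us))
  filter-∷-≤ u us with does (P? u)
  ... | true  = n≤1+n _
  ... | false = ≤-refl

  filter-pair : ∀ {u v} us → P u → P v → 2 ≤ length (filter P? (u ∷ v ∷ us))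
  filter-pair {u} {v} us pu pv
    rewrite filter-accept P? {xs = v ∷ us} pu | filter-accept P? {xs = us} pv = s≤s (s≤s z≤n)

  collapse : A → A → A
  collapse y u with does (P? u)
  ... | true  = y
  ... | false = u

  collapse-yes : ∀ {y u} → P u → collapse y u ≡ y
  collapse-yes {u = u} pu with P? u
  ... | yes _   = refl
  ... | no ¬pu  = ⊥-elim (¬pu pu)

  collapse-no : ∀ {y u} → ¬ P u → collapse y u ≡ u
  collapse-no {u = u} ¬pu with P? u
  ... | yes pu  = ⊥-elim (¬pu pu)
  ... | no _    = refl

  unique-collapse : ∀ {y us} → P y → Unique us → length (filter P? us) ≤ 1
    → Unique (map (collapse y) us)
  unique-collapse py []                    _     = []
  unique-collapse {y} {u ∷ us} py (u∉ ∷ uq) bound with P? u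
  ... | yes _   = All.map⁺ (All.map y-fresh (filter-empty us (n≤0⇒n≡0 (≤-pred bound))))
                  ∷ unique-collapse py uq (≤-trans (n≤1+n _) bound)
    where
    y-fresh : ∀ {v} → ¬ P v → y ≢ collapse y v
    y-fresh ¬pv y≡v = ¬pv (subst P (trans y≡v (collapse-no ¬pv)) py)
  ... | no ¬pu  = All.map⁺ (All.map u-fresh u∉) ∷ unique-collapse py uq bound
    where
    u-fresh : ∀ {v} → u ≢ v → u ≢ collapse y v
    u-fresh {v} u≢v with P? v
    ... | yes _ = λ { refl → ¬pu py }
    ... | no _  = u≢v

floor-third : ∀ {l N} → 3 * l ≤ 3 * N + 2 → l ≤ N
floor-third {l} {N} h with l ≤? N
... | yes l≤N = l≤N
... | no  l≰N = ⊥-elim (1+n≰n (≤-trans too-big h))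
  where
  three-suc : ∀ N → 3 * suc N ≡ suc (3 * N + 2)
  three-suc = solve-∀
  too-big : suc (3 * N + 2) ≤ 3 * l
  too-big = subst (_≤ 3 * l) (three-suc N) (*-monoʳ-≤ 3 (≰⇒> l≰N))

divide-count : ∀ {l W X m q r s vA} → r + s ≡ 3 → vA ≡ r + q * 3 → suc W ≤ vA → X ≤ 1
  → 3 * l ≤ W + s * X + 3 * m → l ≤ q + m
divide-count {l} {W} {X} {m} {q} {r} {s} {vA} r+s≡3 vA≡ W<vA X≤1 count = floor-third (begin
  3 * l               ≤⟨ count ⟩
  W + s * X + 3 * m   ≤⟨ +-monoˡ-≤ (3 * m) (+-monoʳ-≤ W s*X≤s) ⟩
  W + s + 3 * m       ≤⟨ +-monoˡ-≤ (3 * m) W+s≤ ⟩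
  q * 3 + 2 + 3 * m   ≡⟨ regroup q m ⟩
  3 * (q + m) + 2     ∎)
  where
  open ≤-Reasoning
  s*X≤s : s * X ≤ s
  s*X≤s = ≤-trans (*-monoʳ-≤ s X≤1) (≤-reflexive (*-identityʳ s))
  shift : ∀ r q s → r + q * 3 + s ≡ q * 3 + (r + s)
  shift = solve-∀
  regroup : ∀ q m → q * 3 + 2 + 3 * m ≡ 3 * (q + m) + 2
  regroup = solve-∀
  W+s≤ : W + s ≤ q * 3 + 2
  W+s≤ = ≤-pred (begin
    suc W + s          ≤⟨ +-monoˡ-≤ s W<vA ⟩
    vA + s             ≡⟨ cong (_+ s) vA≡ ⟩
    r + q * 3 + s      ≡⟨ shift r q s ⟩
    q * 3 + (r + s)    ≡⟨ cong (q * 3 +_) r+s≡3 ⟩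
    q * 3 + 3          ≡⟨ +-suc (q * 3) 2 ⟩
    suc (q * 3 + 2)    ∎)

residue-split : ∀ {v r} → v % 3 ≡ r → v ≡ r + v / 3 * 3
residue-split {v} refl = m≡m%n+[m/n]*n v 3

quotient-shift : ∀ {v r} → v % 3 ≡ r → (v ∸ r) / 3 ≡ v / 3
quotient-shift {v} {r} h = begin
  (v ∸ r) / 3               ≡⟨ cong (λ m → (m ∸ r) / 3) (residue-split h) ⟩
  (r + v / 3 * 3 ∸ r) / 3   ≡⟨ cong (_/ 3) (m+n∸m≡n r (v / 3 * 3)) ⟩
  v / 3 * 3 / 3             ≡⟨ m*n/n≡m (v / 3) 3 ⟩
  v / 3                     ∎
  where open ≡-Reasoning

-- A path avoiding the cut vertex (c = 0 occurrences) has all or none of its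
-- three vertices (w of them) on the A-side; this is the only input the
-- pathwise estimates below need.
Dichotomy : ℕ → ℕ → Set
Dichotomy w c = c ≡ 0 → w ≡ 0 ⊎ w ≡ 3

heavy₀ : ∀ {w c} → Dichotomy w c → w + c ≢ 0 → 3 ≤ w + 3 * c
heavy₀ {w} {zero} d nonzero with d refl
... | inj₁ refl = ⊥-elim (nonzero refl)
... | inj₂ refl = ≤-refl
heavy₀ {w} {suc c} _ _ = ≤-trans (*-monoʳ-≤ 3 (s≤s z≤n)) (m≤n+m (3 * suc c) w)

heavy₁ : ∀ {w c} → Dichotomy w c → w ≢ 0 → 3 ≤ w + 2 * c
heavy₁ {w} {zero} d nonzero with d refl
... | inj₁ refl = ⊥-elim (nonzero refl)
... | inj₂ refl = ≤-refl
heavy₁ {w} {suc c} _ nonzero = +-mono-≤ (n≢0⇒n>0 nonzero) (*-monoʳ-≤ 2 (s≤s z≤n))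

heavy₂ : ∀ {w c} → Dichotomy w c → ¬ (w ≤ 1) → 3 ≤ w + 1 * c
heavy₂ {w} {zero} d big with d refl
... | inj₁ refl = ⊥-elim (big z≤n)
... | inj₂ refl = ≤-refl
heavy₂ {w} {suc c} _ big = +-mono-≤ (≰⇒> big) (*-monoʳ-≤ 1 (s≤s z≤n))

light-weight : ∀ {w c} → Dichotomy w c → w ≤ 1 → w ≤ c
light-weight {w} {zero} d light with d refl
... | inj₁ refl = z≤n
... | inj₂ refl = ⊥-elim (≤⇒≯ light (s≤s (s≤s z≤n)))
light-weight {w} {suc c} _ light = ≤-trans light (s≤s z≤n)

∨-split : ∀ a b → a ∨ b ≡ true → a ≡ true ⊎ b ≡ true
∨-split true  _ _ = inj₁ refl
∨-split false _ e = inj₂ e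

∨-introˡ : ∀ {a} b → a ≡ true → a ∨ b ≡ true
∨-introˡ _ refl = refl

∨-introʳ : ∀ a {b} → b ≡ true → a ∨ b ≡ true
∨-introʳ a refl = Bool.∨-zeroʳ a

∧-intro : ∀ {a b} → a ≡ true → b ≡ true → a ∧ b ≡ true
∧-intro refl refl = refl

==-refl : (u : Fin n) → (u == u) ≡ true
==-refl u with u ≟ u
... | yes _   = refl
... | no  u≢u = ⊥-elim (u≢u refl)

≢⇒not== : ∀ {u v : Fin n} → u ≢ v → not (u == v) ≡ true
≢⇒not== {u = u} {v} u≢v with u ≟ v
... | yes u≡v = ⊥-elim (u≢v u≡v)
... | no  _   = refl

module _ {n} {H : Graph n} (isH : IsGraph H) where

  edge-source : ∀ {u v} → E H u v ≡ true → V H u ≡ true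
  edge-source {u} {v} = IsGraph.E-V isH u v

  flip-edge : ∀ {u v} → E H u v ≡ true → E H v u ≡ true
  flip-edge {u} {v} e = trans (IsGraph.E-sym isH v u) e

  edge-target : ∀ {u v} → E H u v ≡ true → V H v ≡ true
  edge-target e = edge-source (flip-edge e)

  no-loop : ∀ {u} → E H u u ≡ true → ⊥
  no-loop {u} e with trans (sym e) (IsGraph.E-irr isH u)
  ... | ()

delete-path : ∀ {H : Graph n} {x t} → IsP3 H t → All (_≢ x) (verts t) → IsP3 (H ─ x) t
delete-path (va , vb , vc , ab , bc) (a≢x ∷ b≢x ∷ c≢x ∷ []) =
    ∧-intro va (≢⇒not== a≢x) , ∧-intro vb (≢⇒not== b≢x) , ∧-intro vc (≢⇒not== c≢x)
  , ∧-intro ab (∧-intro (≢⇒not== a≢x) (≢⇒not== b≢x))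
  , ∧-intro bc (∧-intro (≢⇒not== b≢x) (≢⇒not== c≢x))

mapTriple : (Fin n → Fin n) → Triple n → Triple n
mapTriple f (tri a b c) = tri (f a) (f b) (f c)

vertices-map : ∀ (f : Fin n → Fin n) ps → vertices (map (mapTriple f) ps) ≡ map f (vertices ps)
vertices-map f []               = refl
vertices-map f (tri a b c ∷ ps) = cong (λ us → f a ∷ f b ∷ f c ∷ us) (vertices-map f ps)

filter-packing : ∀ {H : Graph n} {q} {Q : Pred (Triple n) q} (Q? : Decidable Q) ps
  → Unique (vertices ps) → All (λ t → Q t → IsP3 H t) ps → HasPacking H (length (filter Q? ps))
filter-packing Q? ps uq paths =
  filter Q? ps , refl , All-filter Q? paths , unique-⊆ (vertices-filter-⊆ Q? ps) uq

map-packing : ∀ {H : Graph n} (f : Fin n → Fin n) ps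
  → Unique (map f (vertices ps)) → All (IsP3 H ∘ mapTriple f) ps → HasPacking H (length ps)
map-packing f ps uq paths =
  map (mapTriple f) ps , length-map (mapTriple f) ps , All.map⁺ paths , subst Unique (sym (vertices-map f ps)) uq

-- The geometry of the cut vertex x, where G = A ∪ B and V(A) ∩ V(B) = {x}

module CutVertex {n} {G A B : Graph n} {x : Fin n}
  (isG : IsGraph G) (isA : IsGraph A) (isB : IsGraph B)
  (union : IsUnion G A B) (meet : MeetExactlyAt A B x) where

  InAx : Pred (Fin n) _
  InAx u = V A u ≡ true × u ≢ x

  inAx? : Decidable InAx
  inAx? u = (V A u Bool.≟ true) ×-dec ¬? (u ≟ x)

  isX? : Decidable (_≡ x)
  isX? u = u ≟ x

  shared-is-x : ∀ {u} → V A u ≡ true → V B u ≡ true → u ≡ x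
  shared-is-x = proj₂ (proj₂ meet) _

  vertex-in-A-or-B : ∀ {u} → V G u ≡ true → V A u ≡ true ⊎ V B u ≡ true
  vertex-in-A-or-B {u} g = ∨-split (V A u) (V B u) (trans (sym (proj₁ union u)) g)

  edge-in-A-or-B : ∀ {u v} → E G u v ≡ true → E A u v ≡ true ⊎ E B u v ≡ true
  edge-in-A-or-B {u} {v} e = ∨-split (E A u v) (E B u v) (trans (sym (proj₂ union u v)) e)

  edge-at-Ax : ∀ {u v} → InAx u → E G u v ≡ true → E A u v ≡ true
  edge-at-Ax (au , u≢x) e with edge-in-A-or-B e
  ... | inj₁ eA = eA
  ... | inj₂ eB = ⊥-elim (u≢x (shared-is-x au (edge-source isB eB)))

  edge-off-A : ∀ {u v} → V A u ≢ true → E G u v ≡ true → E B u v ≡ true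
  edge-off-A ¬au e with edge-in-A-or-B e
  ... | inj₁ eA = ⊥-elim (¬au (edge-source isA eA))
  ... | inj₂ eB = eB

  -- No edge joins A − x to B − x: along an edge of G, A − x can only be left through x.
  Ax-closed : ∀ {u v} → E G u v ≡ true → v ≢ x → InAx u → InAx v
  Ax-closed e v≢x in-u = edge-target isA (edge-at-Ax in-u e) , v≢x

  leave-Ax-at-x : ∀ {u v} → E G u v ≡ true → InAx u → ¬ InAx v → v ≡ x
  leave-Ax-at-x {v = v} e in-u ¬in-v with v ≟ x
  ... | yes v≡x = v≡x
  ... | no  v≢x = ⊥-elim (¬in-v (Ax-closed e v≢x in-u))

  off-Ax-vertex : ∀ {u} → V G u ≡ true → ¬ InAx u → V B u ≡ true
  off-Ax-vertex {u} g ¬in-u with vertex-in-A-or-B g | u ≟ x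
  ... | inj₂ bu | _        = bu
  ... | inj₁ _  | yes refl = proj₁ (proj₂ meet)
  ... | inj₁ au | no u≢x   = ⊥-elim (¬in-u (au , u≢x))

  off-Ax-edge : ∀ {u v} → E G u v ≡ true → ¬ InAx u → ¬ InAx v → E B u v ≡ true
  off-Ax-edge {u} {v} e ¬in-u ¬in-v with u ≟ x
  ... | no  u≢x  = edge-off-A (λ au → ¬in-u (au , u≢x)) e
  ... | yes refl = flip-edge isB (edge-off-A (λ av → ¬in-v (av , v≢x)) (flip-edge isG e))
    where
    v≢x : v ≢ x
    v≢x refl = no-loop isG e

  x-free-path : ∀ {t} → IsP3 G t → All (_≢ x) (verts t) → All InAx (verts t) ⊎ All (∁ InAx) (verts t)
  x-free-path {tri a b c} (_ , _ , _ , ab , bc) (a≢x ∷ b≢x ∷ c≢x ∷ []) with inAx? b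
  ... | yes in-b = inj₁ (Ax-closed (flip-edge isG ab) a≢x in-b ∷ in-b ∷ Ax-closed bc c≢x in-b ∷ [])
  ... | no ¬in-b = inj₂ ( (λ in-a → ¬in-b (Ax-closed ab b≢x in-a)) ∷ ¬in-b
                        ∷ (λ in-c → ¬in-b (Ax-closed (flip-edge isG bc) b≢x in-c)) ∷ [])

  dichotomy : ∀ {t} → IsP3 G t → Dichotomy (occ₃ inAx? t) (occ₃ isX? t)
  dichotomy {t} p no-x with x-free-path p (filter-empty isX? (verts t) no-x)
  ... | inj₁ inside  = inj₂ (cong length (filter-all inAx? inside))
  ... | inj₂ outside = inj₁ (cong length (filter-none inAx? outside))

  off-Ax-path : ∀ {t} → IsP3 G t → occ₃ inAx? t ≡ 0 → IsP3 B t
  off-Ax-path {t} (ga , gb , gc , ab , bc) none with filter-empty inAx? (verts t) none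
  ... | ¬in-a ∷ ¬in-b ∷ ¬in-c ∷ [] =
    off-Ax-vertex ga ¬in-a , off-Ax-vertex gb ¬in-b , off-Ax-vertex gc ¬in-c
    , off-Ax-edge ab ¬in-a ¬in-b , off-Ax-edge bc ¬in-b ¬in-c

  off-A-path : ∀ {t} → IsP3 G t → occ₃ inAx? t + occ₃ isX? t ≡ 0 → IsP3 (B ─ x) t
  off-A-path {t} p none = delete-path {H = B} (off-Ax-path p (m+n≡0⇒m≡0 (occ₃ inAx? t) none))
                                               (filter-empty isX? (verts t) (m+n≡0⇒n≡0 (occ₃ inAx? t) none))

  -- Collapsing A − x onto a neighbour y of x pushes every path of G without an
  -- edge inside A − x into B ∪ xy.
  module Collapse {y} (xy : E A x y ≡ true) where

    y-in-Ax : InAx y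
    y-in-Ax = edge-target isA xy , λ { refl → no-loop isA xy }

    ρ : Fin n → Fin n
    ρ = collapse inAx? y

    collapse-vertex : ∀ {u} → V G u ≡ true → V (addEdge B x y) (ρ u) ≡ true
    collapse-vertex {u} g with inAx? u
    ... | yes in-u rewrite collapse-yes inAx? {y} in-u = ∨-introʳ (V B y) (==-refl y)
    ... | no ¬in-u rewrite collapse-no inAx? {y} ¬in-u = ∨-introˡ _ (off-Ax-vertex g ¬in-u)

    collapse-edge : ∀ {u v} → E G u v ≡ true → ¬ (InAx u × InAx v)
      → E (addEdge B x y) (ρ u) (ρ v) ≡ true
    collapse-edge {u} {v} e not-both with inAx? u | inAx? v
    ... | yes in-u | yes in-v = ⊥-elim (not-both (in-u , in-v))
    ... | yes in-u | no ¬in-v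
      rewrite collapse-yes inAx? {y} in-u | collapse-no inAx? {y} ¬in-v | leave-Ax-at-x e in-u ¬in-v
      = ∨-introʳ (E B y x) (∨-introʳ _ (∧-intro (==-refl y) (==-refl x)))
    ... | no ¬in-u | yes in-v
      rewrite collapse-no inAx? {y} ¬in-u | collapse-yes inAx? {y} in-v
            | leave-Ax-at-x (flip-edge isG e) in-v ¬in-u
      = ∨-introʳ (E B x y) (∨-introˡ _ (∧-intro (==-refl x) (==-refl y)))
    ... | no ¬in-u | no ¬in-v
      rewrite collapse-no inAx? {y} ¬in-u | collapse-no inAx? {y} ¬in-v
      = ∨-introˡ _ (off-Ax-edge e ¬in-u ¬in-v)

    -- A path with at most one vertex in A − x has no edge inside A − x.
    collapse-path : ∀ {t} → IsP3 G t → occ₃ inAx? t ≤ 1 → IsP3 (addEdge B x y) (mapTriple ρ t)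
    collapse-path {tri a b c} (ga , gb , gc , ab , bc) light =
        collapse-vertex ga , collapse-vertex gb , collapse-vertex gc
      , collapse-edge ab (λ (in-a , in-b) → ≤⇒≯ light (filter-pair inAx? (c ∷ []) in-a in-b))
      , collapse-edge bc (λ (in-b , in-c) → ≤⇒≯ light
          (≤-trans (filter-pair inAx? [] in-b in-c) (filter-∷-≤ inAx? a (b ∷ c ∷ []))))

  -- The used vertices of A − x, together with x, are distinct vertices of A.
  A-side-count : ∀ {ps} → Unique (vertices ps) → suc (occ inAx? ps) ≤ v A
  A-side-count {ps} uq =
    count-bound (V A) (x ∷ used) (x-fresh ∷ Unique.filter⁺ inAx? uq)
                (proj₁ meet ∷ All.map proj₁ (All.all-filter inAx? (vertices ps)))
    where
    used = filter inAx? (vertices ps)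
    x-fresh : All (x ≢_) used
    x-fresh = All.map (λ (_ , u≢x) x≡u → u≢x (sym x≡u)) (All.all-filter inAx? (vertices ps))

  x-once : ∀ {ps} → Unique (vertices ps) → occ isX? ps ≤ 1
  x-once {ps} uq = unique-constant (Unique.filter⁺ isX? uq) (All.all-filter isX? (vertices ps))

  -- Light paths (accepted by Q) of a maximum
  -- packing of G form a packing of B'; every heavy path t pays 3 ≤ w(t) + s·c(t)
  -- on the A-side.
  packing-bound : ∀ {q} {Q : Pred (Triple n) q} (B' : Graph n) (Q? : Decidable Q) (r s : ℕ)
    → r + s ≡ 3 → v A % 3 ≡ r
    → (∀ {t} → IsP3 G t → ¬ Q t → 3 ≤ occ₃ inAx? t + s * occ₃ isX? t)
    → (∀ ps → All (IsP3 G) ps → Unique (vertices ps) → HasPacking B' (length (filter Q? ps)))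
    → ∀ l k → IsLambda G l → IsLambda B' k → l ≤ v A / 3 + k
  packing-bound B' Q? r s r+s≡3 residue heavy light-packing _ k ((ps , refl , paths , uq) , _) (_ , maximal) =
    ≤-trans (divide-count {q = v A / 3} {r} {s} r+s≡3 (residue-split residue)
                          (A-side-count {ps} uq) (x-once {ps} uq)
                          (weighted-count inAx? isX? Q? s ps (All.map heavy paths)))
            (+-monoʳ-≤ (v A / 3) (maximal _ (light-packing ps paths uq)))

  part₀ : v A % 3 ≡ 0 → ∀ l k → IsLambda G l → IsLambda (B ─ x) k → l ≤ v A / 3 + k
  part₀ residue = packing-bound (B ─ x) off-A? 0 3 refl residue
    (λ p → heavy₀ (dichotomy p))
    (λ ps paths uq → filter-packing off-A? ps uq (All.map off-A-path paths))
    where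
    off-A? : Decidable (λ t → occ₃ inAx? t + occ₃ isX? t ≡ 0)
    off-A? t = occ₃ inAx? t + occ₃ isX? t Nat.≟ 0

  part₁ : v A % 3 ≡ 1 → ∀ l k → IsLambda G l → IsLambda B k → l ≤ (v A ∸ 1) / 3 + k
  part₁ residue l k λG λB = subst (λ q → l ≤ q + k) (sym (quotient-shift {v A} residue))
    (packing-bound B off-Ax? 1 2 refl residue
      (λ p → heavy₁ (dichotomy p))
      (λ ps paths uq → filter-packing off-Ax? ps uq (All.map off-Ax-path paths))
      l k λG λB)
    where
    off-Ax? : Decidable (λ t → occ₃ inAx? t ≡ 0)
    off-Ax? t = occ₃ inAx? t Nat.≟ 0

  part₂ : v A % 3 ≡ 2 → ∀ y → E A x y ≡ true
    → ∀ l k → IsLambda G l → IsLambda (addEdge B x y) k → l ≤ (v A ∸ 2) / 3 + k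
  part₂ residue y xy l k λG λB = subst (λ q → l ≤ q + k) (sym (quotient-shift {v A} residue))
    (packing-bound (addEdge B x y) light? 2 1 refl residue
      (λ p → heavy₂ (dichotomy p))
      collapse-packing
      l k λG λB)
    where
    open Collapse xy
    light? : Decidable (λ t → occ₃ inAx? t ≤ 1)
    light? t = occ₃ inAx? t ≤? 1

    collapse-packing : ∀ ps → All (IsP3 G) ps → Unique (vertices ps)
      → HasPacking (addEdge B x y) (length (filter light? ps))
    collapse-packing ps paths uq =
      map-packing ρ (filter light? ps)
        (unique-collapse inAx? y-in-Ax (unique-⊆ (vertices-filter-⊆ light? ps) uq) one-A-vertex)
        (All-filter light? (All.map collapse-path paths))
      where
      one-A-vertex : occ inAx? (filter light? ps) ≤ 1
      one-A-vertex = begin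
        occ inAx? (filter light? ps)  ≤⟨ occ-mono inAx? isX? (filter light? ps)
                                           (All-filter light? (All.map (light-weight ∘ dichotomy) paths)) ⟩
        occ isX? (filter light? ps)   ≤⟨ occ-filter isX? light? ps ⟩
        occ isX? ps                   ≤⟨ x-once {ps} uq ⟩
        1                             ∎
        where open ≤-Reasoning

mainTheorem1 : ∀ {n} (G A B : Graph n) (x : Fin n)
    → IsGraph G → IsGraph A → IsGraph B
    → IsUnion G A B
    → Connected A → Connected B
    → 2 ≤ v A → 2 ≤ v B
    → MeetExactlyAt A B x
    → ((v A % 3 ≡ 0) → ∀ l k → IsLambda G l → IsLambda (B ─ x) k → l ≤ v A / 3 + k)
    × ((v A % 3 ≡ 1) → ∀ l k → IsLambda G l → IsLambda B k → l ≤ (v A ∸ 1) / 3 + k)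
    × ((v A % 3 ≡ 2) → ∀ y → E A x y ≡ true
         → ∀ l k → IsLambda G l → IsLambda (addEdge B x y) k → l ≤ (v A ∸ 2) / 3 + k)
mainTheorem1 G A B x isG isA isB union _ _ _ _ meet = part₀ , part₁ , part₂
  where open CutVertex isG isA isB union meet
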